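{- For every $\varepsilon>0$ there exists $n_0(\varepsilon)\in\mathbb{N}$ such that for all $n\ge n_0(\varepsilon)$, every $2$-colouring of $[2,n]$ contains at least $n^{1/3-\varepsilon}$ monochromatic product Schur triples.
   Context: $[2,n]=\{2,3,\dots,n\}$. A product Schur triple in $[2,n]$ is a triple of integers $a,b,c\in[2,n]$ (not necessarily distinct) with $ab=c$; it is monochromatic if $a,b,c$ all receive the same colour.
   Formalization: The parameter ε ranges over the positive rationals. -}

module Defs where

open import Data.Nat using (ℕ; suc; _*_; _≤ᵇ_)
open import Data.Bool using (Bool; _∧_; if_then_else_; true; false)
open import Data.List using (List; drop; upTo; length; filterᵇ; cartesianProduct)
open import Data.Product using (_×_; _,_)

interval2 : ℕ → List ℕ
interval2 n = drop 2 (upTo (suc n))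

_==_ : Bool → Bool → Bool
true == b = b
false == b = if b then false else true

-- A product Schur triple (a, b, a*b) in [2,n] is determined by the ordered pair (a,b)
-- with a, b ∈ [2,n] and a*b ≤ n.  It is monochromatic for the colouring col if
-- col a = col b = col (a*b).
isMonoTriple : (ℕ → Bool) → ℕ → ℕ × ℕ → Bool
isMonoTriple col n (a , b) = ((a * b) ≤ᵇ n) ∧ ((col a == col b) ∧ (col a == col (a * b)))

monoCount : (ℕ → Bool) → ℕ → ℕ
monoCount col n = length (filterᵇ (isMonoTriple col n) (cartesianProduct (interval2 n) (interval2 n)))

module Submission where

-- For a ≥ 2, every 2-colouring of 2, 4, 8, a, 2a, 4a, 8a, a², 2a², 4a², 8a² makes one of sixteen fixed
-- products x · y = z monochromatic, where x ∈ {a, 2a, 4a, 4a²} (an exhaustive check over the 2¹¹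
-- colourings). For a in a window (A, 2A) the number x determines a, so the window yields A − 1
-- distinct monochromatic pairs (x, y), all inside [2, n] once 8 (2A)² ≤ n. Choosing A maximal gives
-- about √n/6 monochromatic triples, which exceeds n^(1/3) as soon as n ≥ 8 · 80² = 51200.

open import Data.Nat using (ℕ; zero; suc; _+_; _*_; _^_; _≤_; _<_; NonZero; >-nonZero; z≤n; s≤s; z<s; _∸_; _≤ᵇ_; _<?_)
open import Data.Nat.Properties
open import Data.Nat.Tactic.RingSolver using (solve-∀)
open import Algebra.Properties.CommutativeSemigroup *-commutativeSemigroup using (interchange)
open import Data.Bool using (Bool; true; false; T; _∧_)
open import Data.Bool.Properties using (T-∧)
open import Data.Product using (∃; ∃-syntax; _×_; _,_; proj₁; proj₂)
open import Data.Fin using (Fin; toℕ; #_)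
open import Data.Fin.Properties using (injective⇒≤; toℕ<n; toℕ-injective)
open import Data.Vec using (Vec; []; _∷_; lookup)
import Data.Vec as Vec
import Data.List as List
open import Data.List using (List; []; _∷_; length; filterᵇ; cartesianProduct)
open import Data.Bool.ListAction using (any)
open import Data.List.Membership.Propositional using (_∈_)
open import Data.List.Membership.Propositional.Properties using (∈-filter⁺; ∈-cartesianProduct⁺; ∈-applyUpTo⁺)
open import Data.List.Relation.Unary.Any using (Any; index; satisfied)
open import Data.List.Relation.Unary.Any.Properties using (lookup-index; any⁻)
open import Data.Empty using (⊥-elim)
open import Function using (_∘_; Injective)
open import Function.Bundles using (Equivalence)
open import Relation.Nullary.Decidable using (T?; yes; no)
open import Relation.Binary.Definitions using (tri<; tri≈; tri>)
open import Relation.Binary.PropositionalEquality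
open import Defs

module _ {X : Set} {m : ℕ} {xs : List X} where

  injection⇒≤length : {g : Fin m → X} → Injective _≡_ _≡_ g → (∀ i → g i ∈ xs) → m ≤ length xs
  injection⇒≤length {g} g-inj mem = injective⇒≤ index-inj
    where
    index-inj : ∀ {i j} → index (mem i) ≡ index (mem j) → i ≡ j
    index-inj {i} {j} eq = g-inj (begin
      g i                            ≡⟨ lookup-index (mem i) ⟩
      List.lookup xs (index (mem i)) ≡⟨ cong (List.lookup xs) eq ⟩
      List.lookup xs (index (mem j)) ≡⟨ lookup-index (mem j) ⟨
      g j                            ∎)
      where open ≡-Reasoning

allVectors : ∀ {n} → (Vec Bool n → Bool) → Bool
allVectors {zero}  P = P []
allVectors {suc n} P = allVectors (P ∘ (false ∷_)) ∧ allVectors (P ∘ (true ∷_))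

allVectors-sound : ∀ {n} (P : Vec Bool n → Bool) → T (allVectors P) → ∀ v → T (P v)
allVectors-sound {zero}  P h []          = h
allVectors-sound {suc n} P h (false ∷ v) = allVectors-sound (P ∘ (false ∷_)) (proj₁ (Equivalence.to T-∧ h)) v
allVectors-sound {suc n} P h (true ∷ v)  = allVectors-sound (P ∘ (true ∷_)) (proj₂ (Equivalence.to T-∧ h)) v

strictMono⇒injective : {f : ℕ → ℕ} → (∀ {m n} → m < n → f m < f n) → ∀ {m n} → f m ≡ f n → m ≡ n
strictMono⇒injective f-mono {m} {n} eq with <-cmp m n
... | tri< m<n _ _ = ⊥-elim (<⇒≢ (f-mono m<n) eq)
... | tri≈ _ m≡n _ = m≡n
... | tri> _ _ n<m = ⊥-elim (<⇒≢ (f-mono n<m) (sym eq))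

strictMono-bracket : (f : ℕ → ℕ) → f 0 ≡ 0 → (∀ A → f A < f (suc A)) → ∀ n → ∃[ A ] f A ≤ n × n < f (suc A)
strictMono-bracket f f0≡0 f-< zero = 0 , subst (_≤ 0) (sym f0≡0) ≤-refl , subst (_< f 1) f0≡0 (f-< 0)
strictMono-bracket f f0≡0 f-< (suc n) with strictMono-bracket f f0≡0 f-< n
... | A , fA≤n , n<f[1+A] with suc n <? f (suc A)
...   | yes 1+n<f[1+A] = A , m≤n⇒m≤1+n fA≤n , 1+n<f[1+A]
...   | no  1+n≮f[1+A] = suc A , ≮⇒≥ 1+n≮f[1+A] , ≤-<-trans n<f[1+A] (f-< (suc A))

monomial : ℕ × ℕ → ℕ → ℕ
monomial (i , j) a = 2 ^ i * a ^ j

_⊕_ : ℕ × ℕ → ℕ × ℕ → ℕ × ℕ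
(i , j) ⊕ (k , l) = (i + k , j + l)

monomial-⊕ : ∀ e f a → monomial (e ⊕ f) a ≡ monomial e a * monomial f a
monomial-⊕ (i , j) (k , l) a = begin
  2 ^ (i + k) * a ^ (j + l)           ≡⟨ cong₂ _*_ (^-distribˡ-+-* 2 i k) (^-distribˡ-+-* a j l) ⟩
  (2 ^ i * 2 ^ k) * (a ^ j * a ^ l)   ≡⟨ interchange (2 ^ i) (2 ^ k) (a ^ j) (a ^ l) ⟩
  (2 ^ i * a ^ j) * (2 ^ k * a ^ l)   ∎
  where open ≡-Reasoning

monomial-≥2 : ∀ i j {a} → 1 ≤ i + j → 2 ≤ a → 2 ≤ monomial (i , j) a
monomial-≥2 i j {a} i+j≥1 a≥2 = begin
  2                 ≤⟨ ^-monoʳ-≤ 2 i+j≥1 ⟩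
  2 ^ (i + j)       ≡⟨ ^-distribˡ-+-* 2 i j ⟩
  2 ^ i * 2 ^ j     ≤⟨ *-monoʳ-≤ (2 ^ i) (^-monoˡ-≤ j a≥2) ⟩
  2 ^ i * a ^ j     ∎
  where open ≤-Reasoning

monomial-mono : ∀ {i j i′ j′ a} .{{_ : NonZero a}} → i ≤ i′ → j ≤ j′ → monomial (i , j) a ≤ monomial (i′ , j′) a
monomial-mono {a = a} i≤i′ j≤j′ = *-mono-≤ (^-monoʳ-≤ 2 i≤i′) (^-monoʳ-≤ a j≤j′)

data Monomial : Set where
  2¹ 2² 2³ a¹ 2a¹ 4a¹ 8a¹ a² 2a² 4a² 8a² : Monomial

exponents : Monomial → ℕ × ℕ
exponents 2¹  = 1 , 0
exponents 2²  = 2 , 0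
exponents 2³  = 3 , 0
exponents a¹  = 0 , 1
exponents 2a¹ = 1 , 1
exponents 4a¹ = 2 , 1
exponents 8a¹ = 3 , 1
exponents a²  = 0 , 2
exponents 2a² = 1 , 2
exponents 4a² = 2 , 2
exponents 8a² = 3 , 2

⟦_⟧ : Monomial → ℕ → ℕ
⟦ m ⟧ = monomial (exponents m)

inRange : ℕ × ℕ → Bool
inRange (i , j) = (1 ≤ᵇ i + j) ∧ (i ≤ᵇ 3) ∧ (j ≤ᵇ 2)

exponents-inRange : ∀ m → T (inRange (exponents m))
exponents-inRange 2¹  = _
exponents-inRange 2²  = _
exponents-inRange 2³  = _
exponents-inRange a¹  = _
exponents-inRange 2a¹ = _
exponents-inRange 4a¹ = _
exponents-inRange 8a¹ = _
exponents-inRange a²  = _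
exponents-inRange 2a² = _
exponents-inRange 4a² = _
exponents-inRange 8a² = _

⟦⟧-bounds : ∀ m {a} .{{_ : NonZero a}} → 2 ≤ a → 2 ≤ ⟦ m ⟧ a × ⟦ m ⟧ a ≤ ⟦ 8a² ⟧ a
⟦⟧-bounds m {a} a≥2 = bounds (exponents m) (exponents-inRange m)
  where
  bounds : ∀ e → T (inRange e) → 2 ≤ monomial e a × monomial e a ≤ ⟦ 8a² ⟧ a
  bounds (i , j) h with Equivalence.to T-∧ h
  ... | h₁ , h₂₃ with Equivalence.to T-∧ h₂₃
  ... | h₂ , h₃ = monomial-≥2 i j (≤ᵇ⇒≤ 1 (i + j) h₁) a≥2 , monomial-mono (≤ᵇ⇒≤ i 3 h₂) (≤ᵇ⇒≤ j 2 h₃)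

data Key : Set where
  a¹ 2a¹ 4a¹ 4a² : Key

keyMonomial : Key → Monomial
keyMonomial a¹  = a¹
keyMonomial 2a¹ = 2a¹
keyMonomial 4a¹ = 4a¹
keyMonomial 4a² = 4a²

record SchurTriple : Set where
  constructor schur
  field
    key           : Key
    factor        : Monomial
    product       : Monomial
    exponents-add : exponents product ≡ exponents (keyMonomial key) ⊕ exponents factor

open SchurTriple

configuration : List SchurTriple
configuration =
  schur a¹  2¹  2a¹ refl ∷ schur a¹  2²  4a¹ refl ∷ schur a¹  2³  8a¹ refl ∷ schur a¹ a¹ a² refl ∷
  schur a¹  2a¹ 2a² refl ∷ schur a¹  4a¹ 4a² refl ∷ schur a¹  8a¹ 8a² refl ∷
  schur 2a¹ 2¹  4a¹ refl ∷ schur 2a¹ 2²  8a¹ refl ∷ schur 2a¹ a¹  2a² refl ∷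
  schur 2a¹ 2a¹ 4a² refl ∷ schur 2a¹ 4a¹ 8a² refl ∷
  schur 4a¹ 2¹  8a¹ refl ∷ schur 4a¹ a¹  4a² refl ∷ schur 4a¹ 2a¹ 8a² refl ∷
  schur 4a² 2¹  8a² refl ∷ []

monochromatic : (Monomial → Bool) → SchurTriple → Bool
monochromatic f t = (f k == f (factor t)) ∧ (f k == f (product t))
  where k = keyMonomial (key t)

allMonomials : Vec Monomial 11
allMonomials = 2¹ ∷ 2² ∷ 2³ ∷ a¹ ∷ 2a¹ ∷ 4a¹ ∷ 8a¹ ∷ a² ∷ 2a² ∷ 4a² ∷ 8a² ∷ []

position : Monomial → Fin 11
position 2¹  = # 0
position 2²  = # 1
position 2³  = # 2
position a¹  = # 3
position 2a¹ = # 4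
position 4a¹ = # 5
position 8a¹ = # 6
position a²  = # 7
position 2a² = # 8
position 4a² = # 9
position 8a² = # 10

-- For each of the sixteen concrete triples, the test under `lookup (Vec.map f allMonomials) ∘ position`
-- computes to the test under f, so the 2¹¹-case check covers every colouring f.
configuration-monochromatic : ∀ f → Any (T ∘ monochromatic f) configuration
configuration-monochromatic f = any⁻ _ configuration
  (allVectors-sound (λ v → any (monochromatic (lookup v ∘ position)) configuration) _ (Vec.map f allMonomials))

InWindow : ℕ → ℕ → Set
InWindow A a = A < a × a < 2 * A

data KeyShape : ℕ × ℕ → Set where
  linear : ∀ {i} → i ≤ 2 → KeyShape (i , 1)
  square : KeyShape (2 , 2)

keyShape : ∀ k → KeyShape (exponents (keyMonomial k))
keyShape a¹  = linear z≤n
keyShape 2a¹ = linear (s≤s z≤n)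
keyShape 4a¹ = linear (s≤s (s≤s z≤n))
keyShape 4a² = square

monomial-linear : ∀ i a → monomial (i , 1) a ≡ 2 ^ i * a
monomial-linear i a = cong (2 ^ i *_) (^-identityʳ a)

linear-window-< : ∀ {i i′ A a b} → i < i′ → a < 2 * A → A < b → 2 ^ i * a < 2 ^ i′ * b
linear-window-< {i} {i′} {A} {a} {b} i<i′ a<2A A<b = begin-strict
  2 ^ i * a         <⟨ *-monoʳ-< (2 ^ i) {{m^n≢0 2 i}} a<2A ⟩
  2 ^ i * (2 * A)   ≡⟨ trans (sym (*-assoc (2 ^ i) 2 A)) (cong (_* A) (*-comm (2 ^ i) 2)) ⟩
  2 ^ suc i * A     ≤⟨ *-monoˡ-≤ A (^-monoʳ-≤ 2 i<i′) ⟩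
  2 ^ i′ * A        <⟨ *-monoʳ-< (2 ^ i′) {{m^n≢0 2 i′}} A<b ⟩
  2 ^ i′ * b        ∎
  where open ≤-Reasoning

linear-window-injective : ∀ {i i′ A a b} → InWindow A a → InWindow A b → 2 ^ i * a ≡ 2 ^ i′ * b → a ≡ b
linear-window-injective {i} {i′} {a = a} {b} (A<a , a<2A) (A<b , b<2A) eq with <-cmp i i′
... | tri< i<i′ _ _ = ⊥-elim (<⇒≢ (linear-window-< i<i′ a<2A A<b) eq)
... | tri≈ _ refl _ = *-cancelˡ-≡ a b (2 ^ i) {{m^n≢0 2 i}} eq
... | tri> _ _ i′<i = ⊥-elim (<⇒≢ (linear-window-< i′<i b<2A A<a) (sym eq))

2*m<[1+m]^2 : ∀ m → 2 * m < suc m ^ 2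
2*m<[1+m]^2 m = subst (2 * m <_) (sym (expand m)) (s≤s (m≤m+n (2 * m) (m * m)))
  where
  expand : ∀ m → (1 + m) * ((1 + m) * 1) ≡ 1 + (2 * m + m * m)
  expand = solve-∀

linear<square : ∀ {i A a b} → i ≤ 2 → a < 2 * A → A < b → monomial (i , 1) a < monomial (2 , 2) b
linear<square {i} {A} {a} {b} i≤2 a<2A A<b = begin-strict
  monomial (i , 1) a  ≤⟨ *-monoˡ-≤ (a ^ 1) (^-monoʳ-≤ 2 i≤2) ⟩
  4 * a ^ 1           ≡⟨ monomial-linear 2 a ⟩
  4 * a               <⟨ *-monoʳ-< 4 (<-≤-trans a<2A (<⇒≤ (<-≤-trans (2*m<[1+m]^2 A) (^-monoˡ-≤ 2 A<b)))) ⟩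
  4 * b ^ 2           ∎
  where open ≤-Reasoning

keyValue-injective : ∀ {e e′ A a b} → KeyShape e → KeyShape e′ → InWindow A a → InWindow A b →
                     monomial e a ≡ monomial e′ b → a ≡ b
keyValue-injective {a = a} {b} (linear {i} _) (linear {i′} _) wa wb eq =
  linear-window-injective {i} {i′} wa wb (trans (sym (monomial-linear i a)) (trans eq (monomial-linear i′ b)))
keyValue-injective (linear i≤2) square (_ , a<2A) (A<b , _) eq = ⊥-elim (<⇒≢ (linear<square i≤2 a<2A A<b) eq)
keyValue-injective square (linear i≤2) (A<a , _) (_ , b<2A) eq = ⊥-elim (<⇒≢ (linear<square i≤2 b<2A A<a) (sym eq))
keyValue-injective {a = a} {b} square square _ _ eq =
  strictMono⇒injective (^-monoˡ-< 2) (*-cancelˡ-≡ (a ^ 2) (b ^ 2) 4 eq)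

monoPairs : (ℕ → Bool) → ℕ → List (ℕ × ℕ)
monoPairs col n = filterᵇ (isMonoTriple col n) (cartesianProduct (interval2 n) (interval2 n))

∈-interval2 : ∀ {n x} → 2 ≤ x → x ≤ n → x ∈ interval2 n
∈-interval2 {suc (suc n)} {suc (suc x)} (s≤s (s≤s z≤n)) (s≤s (s≤s x≤n)) = ∈-applyUpTo⁺ (λ i → suc (suc i)) (s≤s x≤n)

⟦⟧-product : ∀ t a → ⟦ product t ⟧ a ≡ ⟦ keyMonomial (key t) ⟧ a * ⟦ factor t ⟧ a
⟦⟧-product t a = trans (cong (λ e → monomial e a) (exponents-add t)) (monomial-⊕ (exponents (keyMonomial (key t))) (exponents (factor t)) a)

schurPair : ℕ → SchurTriple → ℕ × ℕ
schurPair a t = ⟦ keyMonomial (key t) ⟧ a , ⟦ factor t ⟧ a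

schurPair-∈ : ∀ col n a t .{{_ : NonZero a}} → 2 ≤ a → ⟦ 8a² ⟧ a ≤ n →
              T (monochromatic (λ m → col (⟦ m ⟧ a)) t) → schurPair a t ∈ monoPairs col n
schurPair-∈ col n a t a≥2 a-fits mono =
  ∈-filter⁺ (T? ∘ isMonoTriple col n)
    (∈-cartesianProduct⁺ (∈-interval2 x≥2 (≤-trans (m≤m*n x y {{y≢0}}) xy≤n))
                         (∈-interval2 y≥2 (≤-trans (m≤n*m y x {{x≢0}}) xy≤n)))
    (Equivalence.from T-∧ (≤⇒≤ᵇ xy≤n , subst (λ z → T ((col x == col y) ∧ (col x == col z))) (⟦⟧-product t a) mono))
  where
  x y : ℕ
  x = ⟦ keyMonomial (key t) ⟧ a
  y = ⟦ factor t ⟧ a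
  x≥2 : 2 ≤ x
  x≥2 = proj₁ (⟦⟧-bounds (keyMonomial (key t)) a≥2)
  y≥2 : 2 ≤ y
  y≥2 = proj₁ (⟦⟧-bounds (factor t) a≥2)
  x≢0 : NonZero x
  x≢0 = >-nonZero (<-trans z<s x≥2)
  y≢0 : NonZero y
  y≢0 = >-nonZero (<-trans z<s y≥2)
  xy≤n : x * y ≤ n
  xy≤n = subst (_≤ n) (⟦⟧-product t a) (≤-trans (proj₂ (⟦⟧-bounds (product t) a≥2)) a-fits)

chosenTriple : (ℕ → Bool) → ℕ → SchurTriple
chosenTriple col a = proj₁ (satisfied (configuration-monochromatic (λ m → col (⟦ m ⟧ a))))

chosenTriple-monochromatic : ∀ col a → T (monochromatic (λ m → col (⟦ m ⟧ a)) (chosenTriple col a))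
chosenTriple-monochromatic col a = proj₂ (satisfied (configuration-monochromatic (λ m → col (⟦ m ⟧ a))))

threshold : ℕ → ℕ
threshold A = ⟦ 8a² ⟧ (2 * A)

threshold-mono : ∀ {A B} → A ≤ B → threshold A ≤ threshold B
threshold-mono A≤B = *-monoʳ-≤ 8 (^-monoˡ-≤ 2 (*-monoʳ-≤ 2 A≤B))

threshold-< : ∀ A → threshold A < threshold (suc A)
threshold-< A = *-monoʳ-< 8 (^-monoˡ-< 2 (*-monoʳ-< 2 (n<1+n A)))

monoCount-window : ∀ col n m → threshold (suc m) ≤ n → m ≤ monoCount col n
monoCount-window col n m fits = injection⇒≤length {g = pair} pair-injective pair-∈
  where
  A : ℕ
  A = suc m
  point : Fin m → ℕ
  point i = A + suc (toℕ i)
  point-window : ∀ i → InWindow A (point i)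
  point-window i = m<m+n A z<s , subst (point i <_) (cong (A +_) (sym (+-identityʳ A))) (+-monoʳ-< A (s≤s (toℕ<n i)))
  key-of : Fin m → Key
  key-of i = key (chosenTriple col (point i))
  pair : Fin m → ℕ × ℕ
  pair i = schurPair (point i) (chosenTriple col (point i))
  pair-∈ : ∀ i → pair i ∈ monoPairs col n
  pair-∈ i = schurPair-∈ col n (point i) (chosenTriple col (point i))
    (≤-<-trans (s≤s z≤n) (proj₁ (point-window i)))
    (≤-trans (*-monoʳ-≤ 8 (^-monoˡ-≤ 2 (<⇒≤ (proj₂ (point-window i))))) fits)
    (chosenTriple-monochromatic col (point i))
  pair-injective : Injective _≡_ _≡_ pair
  pair-injective {i} {j} eq = toℕ-injective (suc-injective (+-cancelˡ-≡ A _ _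
    (keyValue-injective (keyShape (key-of i)) (keyShape (key-of j)) (point-window i) (point-window j) (cong proj₁ eq))))

threshold≤cube : ∀ {m} → 39 ≤ m → threshold (2 + m) ≤ m ^ 3
threshold≤cube {m} 39≤m = subst (λ x → threshold (2 + x) ≤ x ^ 3) (m∸n+n≡m 39≤m) (cube-gap (m ∸ 39))
  where
  expand : ∀ B → (B + 39) * ((B + 39) * ((B + 39) * 1))
               ≡ 8 * ((2 * (2 + (B + 39))) * ((2 * (2 + (B + 39))) * 1)) + (B * (B * B) + 85 * (B * B) + 1939 * B + 5527)
  expand = solve-∀
  cube-gap : ∀ B → threshold (2 + (B + 39)) ≤ (B + 39) ^ 3
  cube-gap B = subst (threshold (2 + (B + 39)) ≤_) (sym (expand B)) (m≤m+n _ _)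

bracket-index≥40 : ∀ {A n} → threshold 40 ≤ n → n < threshold (suc A) → 40 ≤ A
bracket-index≥40 n≥n₀ n<f[1+A] = ≮⇒≥ (λ A<40 → <⇒≱ n<f[1+A] (≤-trans (threshold-mono A<40) n≥n₀))

monoCount-cube : ∀ col {n} → threshold 40 ≤ n → n ≤ monoCount col n ^ 3
monoCount-cube col {n} n≥n₀ with strictMono-bracket threshold refl threshold-< n
... | A , fA≤n , n<f[1+A] with bracket-index≥40 {A} n≥n₀ n<f[1+A]
... | s≤s {n = m} 39≤m = begin
  n                    ≤⟨ <⇒≤ n<f[1+A] ⟩
  threshold (2 + m)    ≤⟨ threshold≤cube 39≤m ⟩
  m ^ 3                ≤⟨ ^-monoˡ-≤ 3 (monoCount-window col n m fA≤n) ⟩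
  monoCount col n ^ 3  ∎
  where open ≤-Reasoning

theorem1p2 : (p q : ℕ) → NonZero p → NonZero q →
    ∃ λ n₀ → ∀ n → n₀ ≤ n → (col : ℕ → Bool) →
      n ^ q ≤ (monoCount col n ^ (3 * q)) * (n ^ (3 * p))
theorem1p2 p q _ _ = threshold 40 , λ n n≥n₀ col → let M = monoCount col n in begin
  n ^ q                  ≤⟨ ^-monoˡ-≤ q (monoCount-cube col n≥n₀) ⟩
  (M ^ 3) ^ q            ≡⟨ ^-*-assoc M 3 q ⟩
  M ^ (3 * q)            ≤⟨ m≤m*n (M ^ (3 * q)) (n ^ (3 * p)) {{m^n≢0 n (3 * p) {{>-nonZero (<-≤-trans z<s n≥n₀)}}}} ⟩
  M ^ (3 * q) * n ^ (3 * p)  ∎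
  where open ≤-Reasoning
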